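{- Let $\mathbf L=(L,\vee,\wedge)$ be a finite lattice with least element $0$ and greatest element $1$, and let $a,b\in L$ with $a<b$. Then (i) $|P_{\{a,b\}}(\mathbf L)|$ is even; (ii) $|P_{\{a,b\}}(\mathbf L)|\geq2|[0,a]|\cdot|[b,1]|$.
   Context: For a lattice $\mathbf L$ and $S\subseteq L$, $P_S(\mathbf L):=\{(x,y)\in L^2\mid x\wedge y\leq z\leq x\vee y\text{ for all }z\in S\}$. $[c,d]$ denotes the interval $\{x\in L\mid c\leq x\leq d\}$. -}

module Defs where

open import Level using (0ℓ)
open import Data.Nat using (ℕ)
open import Data.Fin using (Fin)
open import Data.Fin.Properties using (_≟_)
open import Data.Product using (_×_; _,_; proj₁; proj₂)
open import Data.List using (List; length; filter; allFin; cartesianProduct; _∷_; [])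
open import Data.List.Relation.Unary.All using (All; all?)
open import Relation.Binary.Core using (Rel)
open import Relation.Binary.Definitions using (Decidable)
open import Relation.Binary.PropositionalEquality using (_≡_; subst)
open import Relation.Binary.Lattice.Structures using (IsLattice)
open import Relation.Nullary using (Dec; yes; no; _×-dec_)
open import Algebra.Core using (Op₂)

-- A finite lattice is represented (up to isomorphism) as a lattice whose
-- carrier is Fin n, with propositional equality as the underlying equality.
module FinLattice {n : ℕ} {_≤_ : Rel (Fin n) 0ℓ} {_∨_ _∧_ : Op₂ (Fin n)}
                  (L : IsLattice _≡_ _≤_ _∨_ _∧_) where
  open IsLattice L

  _≤?_ : Decidable _≤_
  x ≤? y with (x ∧ y) ≟ x
  ... | yes e = yes (subst (_≤ y) e (x∧y≤y x y))
  ... | no ne = no (λ x≤y → ne (antisym (x∧y≤x x y) (∧-greatest refl x≤y)))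

  Between : Fin n → Fin n → Fin n → Set
  Between x y z = ((x ∧ y) ≤ z) × (z ≤ (x ∨ y))

  InP : List (Fin n) → Fin n × Fin n → Set
  InP S (x , y) = All (Between x y) S

  InP? : (S : List (Fin n)) → (p : Fin n × Fin n) → Dec (InP S p)
  InP? S (x , y) = all? (λ z → ((x ∧ y) ≤? z) ×-dec (z ≤? (x ∨ y))) S

  cardP : List (Fin n) → ℕ
  cardP S = length (filter (InP? S) (cartesianProduct (allFin n) (allFin n)))

  cardInterval : Fin n → Fin n → ℕ
  cardInterval c d = length (filter (λ x → (c ≤? x) ×-dec (x ≤? d)) (allFin n))

module Submission where

-- P_{a,b} is a symmetric relation on L, and it is irreflexive because x ∧ x ≤ z ≤ x ∨ x
-- forces z = x, which cannot hold for both z = a and z = b. Its pairs therefore come in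
-- mirror pairs {(x , y), (y , x)}, so |P_{a,b}| is even. For x ≤ a and b ≤ y both (x , y)
-- and (y , x) lie in P_{a,b}, and these 2 |[0,a]| |[b,1]| pairs are distinct because b ≰ a.

open import Defs
open import Level using (0ℓ)
open import Algebra.Core using (Op₂)
open import Data.Fin using (Fin)
open import Data.List using (List; []; _∷_; _++_; map; length; filter; allFin; cartesianProduct)
open import Data.List.Properties using (map-++; map-∘)
open import Data.List.Relation.Unary.All as All using (_∷_; [])
open import Data.Nat using (ℕ; suc; _+_; _*_; _≤_; z≤n)
open import Data.Nat.Divisibility using (_∣_; ∣m∣n⇒∣m+n; m∣m*n)
open import Data.Nat.ListAction using (sum)
import Data.Nat.ListAction.Properties as Sum
open import Data.Nat.Properties
  using ( +-assoc; +-identityʳ; +-mono-≤; ≤-refl; *-zeroʳ; *-assoc; *-distribˡ-+; *-distribʳ-+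
        ; +-commutativeSemigroup; module ≤-Reasoning)
import Algebra.Properties.CommutativeSemigroup as CommSemigroupProperties
open import Data.Product using (_×_; _,_; proj₁; proj₂)
open import Data.Empty using (⊥-elim)
open import Function using (_∘_; flip)
open import Relation.Binary.Core using (Rel)
open import Relation.Binary.Lattice.Structures using (IsLattice; IsBoundedLattice)
open import Relation.Binary.PropositionalEquality
  using (_≡_; _≢_; refl; sym; trans; cong; cong₂; subst; module ≡-Reasoning)
open import Relation.Nullary using (Dec; yes; no; ¬_; _×-dec_)
open import Relation.Unary using (Pred; Decidable)

open CommSemigroupProperties +-commutativeSemigroup using (interchange)

χ : {P : Set} → Dec P → ℕ
χ (yes _) = 1
χ (no _)  = 0

χ-cong : {P Q : Set} → (P → Q) → (Q → P) → (p : Dec P) (q : Dec Q) → χ p ≡ χ q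
χ-cong P⇒Q Q⇒P (yes _) (yes _) = refl
χ-cong P⇒Q Q⇒P (yes p) (no ¬q) = ⊥-elim (¬q (P⇒Q p))
χ-cong P⇒Q Q⇒P (no ¬p) (yes q) = ⊥-elim (¬p (Q⇒P q))
χ-cong P⇒Q Q⇒P (no _)  (no _)  = refl

χ-×-dec : {P Q : Set} (p : Dec P) (q : Dec Q) → χ (p ×-dec q) ≡ χ p * χ q
χ-×-dec (yes _) (yes _) = refl
χ-×-dec (yes _) (no _)  = refl
χ-×-dec (no _)  _       = refl

χ-≡0 : {P : Set} → ¬ P → (p : Dec P) → χ p ≡ 0
χ-≡0 ¬p (yes p) = ⊥-elim (¬p p)
χ-≡0 ¬p (no _)  = refl

χ+χ≤χ : {P Q R : Set} → (P → R) → (Q → R) → ¬ (P × Q) →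
        (p : Dec P) (q : Dec Q) (r : Dec R) → χ p + χ q ≤ χ r
χ+χ≤χ P⇒R Q⇒R disjoint (yes p) (yes q) _       = ⊥-elim (disjoint (p , q))
χ+χ≤χ P⇒R Q⇒R disjoint (yes _) (no _)  (yes _) = ≤-refl
χ+χ≤χ P⇒R Q⇒R disjoint (yes p) (no _)  (no ¬r) = ⊥-elim (¬r (P⇒R p))
χ+χ≤χ P⇒R Q⇒R disjoint (no _)  (yes _) (yes _) = ≤-refl
χ+χ≤χ P⇒R Q⇒R disjoint (no _)  (yes q) (no ¬r) = ⊥-elim (¬r (Q⇒R q))
χ+χ≤χ P⇒R Q⇒R disjoint (no _)  (no _)  _       = z≤n

∑ : {A : Set} → List A → (A → ℕ) → ℕ
∑ xs f = sum (map f xs)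

module _ {A : Set} where

  ∑-cong : ∀ xs {f g : A → ℕ} → (∀ x → f x ≡ g x) → ∑ xs f ≡ ∑ xs g
  ∑-cong []       f≗g = refl
  ∑-cong (x ∷ xs) f≗g = cong₂ _+_ (f≗g x) (∑-cong xs f≗g)

  ∑-mono-≤ : ∀ xs {f g : A → ℕ} → (∀ x → f x ≤ g x) → ∑ xs f ≤ ∑ xs g
  ∑-mono-≤ []       f≤g = z≤n
  ∑-mono-≤ (x ∷ xs) f≤g = +-mono-≤ (f≤g x) (∑-mono-≤ xs f≤g)

  ∑-+ : ∀ xs (f g : A → ℕ) → ∑ xs (λ x → f x + g x) ≡ ∑ xs f + ∑ xs g
  ∑-+ []       f g = refl
  ∑-+ (x ∷ xs) f g = begin
    (f x + g x) + ∑ xs (λ x → f x + g x) ≡⟨ cong (f x + g x +_) (∑-+ xs f g) ⟩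
    (f x + g x) + (∑ xs f + ∑ xs g)      ≡⟨ interchange (f x) (g x) (∑ xs f) (∑ xs g) ⟩
    (f x + ∑ xs f) + (g x + ∑ xs g)      ∎
    where open ≡-Reasoning

  ∑-*ˡ : ∀ xs c (f : A → ℕ) → ∑ xs (λ x → c * f x) ≡ c * ∑ xs f
  ∑-*ˡ []       c f = sym (*-zeroʳ c)
  ∑-*ˡ (x ∷ xs) c f =
    trans (cong (c * f x +_) (∑-*ˡ xs c f)) (sym (*-distribˡ-+ c (f x) (∑ xs f)))

  ∑-*ʳ : ∀ xs c (f : A → ℕ) → ∑ xs (λ x → f x * c) ≡ ∑ xs f * c
  ∑-*ʳ []       c f = refl
  ∑-*ʳ (x ∷ xs) c f =
    trans (cong (f x * c +_) (∑-*ʳ xs c f)) (sym (*-distribʳ-+ c (f x) (∑ xs f)))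

  ∑-++ : ∀ xs ys (f : A → ℕ) → ∑ (xs ++ ys) f ≡ ∑ xs f + ∑ ys f
  ∑-++ xs ys f = trans (cong sum (map-++ f xs ys)) (Sum.sum-++ (map f xs) (map f ys))

  length-filter≡∑χ : {P : Pred A 0ℓ} (P? : Decidable P) → ∀ xs →
                     length (filter P? xs) ≡ ∑ xs (χ ∘ P?)
  length-filter≡∑χ P? []       = refl
  length-filter≡∑χ P? (x ∷ xs) with P? x
  ... | yes _ = cong suc (length-filter≡∑χ P? xs)
  ... | no  _ = length-filter≡∑χ P? xs

∑-map : {A B : Set} (g : A → B) → ∀ xs (f : B → ℕ) → ∑ (map g xs) f ≡ ∑ xs (f ∘ g)
∑-map g xs f = cong sum (sym (map-∘ xs))

∑-comm : {A B : Set} → ∀ xs ys (f : A → B → ℕ) →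
         ∑ xs (λ x → ∑ ys (f x)) ≡ ∑ ys (λ y → ∑ xs (flip f y))
∑-comm []       ys f = sym (∑-zero ys)
  where
  ∑-zero : ∀ {B : Set} (ys : List B) → ∑ ys (λ _ → 0) ≡ 0
  ∑-zero []       = refl
  ∑-zero (_ ∷ ys) = ∑-zero ys
∑-comm (x ∷ xs) ys f =
  trans (cong (∑ ys (f x) +_) (∑-comm xs ys f)) (sym (∑-+ ys (f x) (λ y → ∑ xs (flip f y))))

∑-cartesianProduct : {A B : Set} → ∀ xs ys (f : A × B → ℕ) →
                     ∑ (cartesianProduct xs ys) f ≡ ∑ xs (λ x → ∑ ys (λ y → f (x , y)))
∑-cartesianProduct []       ys f = refl
∑-cartesianProduct (x ∷ xs) ys f = begin
  ∑ (map (x ,_) ys ++ cartesianProduct xs ys) f      ≡⟨ ∑-++ (map (x ,_) ys) _ f ⟩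
  ∑ (map (x ,_) ys) f + ∑ (cartesianProduct xs ys) f ≡⟨ cong₂ _+_ (∑-map (x ,_) ys f) (∑-cartesianProduct xs ys f) ⟩
  ∑ ys (λ y → f (x , y)) + ∑ xs (λ x → ∑ ys (λ y → f (x , y))) ∎
  where open ≡-Reasoning

module _ {A : Set} where

  ∑∑ : List A → (A → A → ℕ) → ℕ
  ∑∑ xs f = ∑ xs (λ x → ∑ xs (f x))

  ∑∑-flip : ∀ xs (f : A → A → ℕ) → ∑∑ xs (flip f) ≡ ∑∑ xs f
  ∑∑-flip xs f = ∑-comm xs xs (flip f)

  ∑∑-+ : ∀ xs (f g : A → A → ℕ) → ∑∑ xs (λ x y → f x y + g x y) ≡ ∑∑ xs f + ∑∑ xs g
  ∑∑-+ xs f g = trans (∑-cong xs (λ x → ∑-+ xs (f x) (g x))) (∑-+ xs _ _)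

  ∑∑-symmetrise : ∀ xs (f : A → A → ℕ) → ∑∑ xs (λ x y → f x y + f y x) ≡ 2 * ∑∑ xs f
  ∑∑-symmetrise xs f = begin
    ∑∑ xs (λ x y → f x y + f y x) ≡⟨ ∑∑-+ xs f (flip f) ⟩
    ∑∑ xs f + ∑∑ xs (flip f)      ≡⟨ cong (∑∑ xs f +_) (∑∑-flip xs f) ⟩
    ∑∑ xs f + ∑∑ xs f             ≡⟨ cong (∑∑ xs f +_) (sym (+-identityʳ _)) ⟩
    2 * ∑∑ xs f                   ∎
    where open ≡-Reasoning

  ∑∑-separable : ∀ xs (f g : A → ℕ) → ∑∑ xs (λ x y → f x * g y) ≡ ∑ xs f * ∑ xs g
  ∑∑-separable xs f g = trans (∑-cong xs (λ x → ∑-*ˡ xs (f x) g)) (∑-*ʳ xs (∑ xs g) f)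

  -- Peeling off the first element z adds f z z plus the row and the column of z,
  -- which are equal.
  ∑∑-even : ∀ xs (f : A → A → ℕ) → (∀ x y → f x y ≡ f y x) → (∀ x → f x x ≡ 0) →
            2 ∣ ∑∑ xs f
  ∑∑-even []       f symmetric diagonal = m∣m*n 0
  ∑∑-even (z ∷ zs) f symmetric diagonal =
    subst (2 ∣_) (sym peel) (∣m∣n⇒∣m+n (m∣m*n row) (∑∑-even zs f symmetric diagonal))
    where
    open ≡-Reasoning
    row : ℕ
    row = ∑ zs (f z)
    peel : ∑∑ (z ∷ zs) f ≡ 2 * row + ∑∑ zs f
    peel = begin
      (f z z + row) + ∑ zs (λ x → f x z + ∑ zs (f x))  ≡⟨ cong₂ _+_ (cong (_+ row) (diagonal z)) (∑-+ zs (flip f z) _) ⟩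
      row + (∑ zs (flip f z) + ∑∑ zs f)                 ≡⟨ cong (λ column → row + (column + ∑∑ zs f)) (∑-cong zs (λ x → symmetric x z)) ⟩
      row + (row + ∑∑ zs f)                             ≡⟨ sym (+-assoc row row _) ⟩
      (row + row) + ∑∑ zs f                             ≡⟨ cong (λ r → (row + r) + ∑∑ zs f) (sym (+-identityʳ row)) ⟩
      2 * row + ∑∑ zs f                                 ∎

module _ {n : ℕ} {_⊑_ : Rel (Fin n) 0ℓ} {_∨_ _∧_ : Op₂ (Fin n)}
         (L : IsLattice _≡_ _⊑_ _∨_ _∧_) where
  open IsLattice L
    using (x≤x∨y; y≤x∨y; ∨-least; x∧y≤x; x∧y≤y; ∧-greatest)
    renaming (refl to ⊑-refl; trans to ⊑-trans; antisym to ⊑-antisym)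
  open FinLattice L

  Between-comm : ∀ {x y z} → Between x y z → Between y x z
  Between-comm {x} {y} (x∧y⊑z , z⊑x∨y) =
    ⊑-trans (∧-greatest (x∧y≤y y x) (x∧y≤x y x)) x∧y⊑z ,
    ⊑-trans z⊑x∨y (∨-least (y≤x∨y y x) (x≤x∨y y x))

  Between-diag : ∀ {x z} → Between x x z → z ≡ x
  Between-diag {x} (x∧x⊑z , z⊑x∨x) =
    ⊑-antisym (⊑-trans z⊑x∨x (∨-least ⊑-refl ⊑-refl)) (⊑-trans (∧-greatest ⊑-refl ⊑-refl) x∧x⊑z)

  Between-of-⊑ : ∀ {x y z} → x ⊑ z → z ⊑ y → Between x y z
  Between-of-⊑ {x} {y} x⊑z z⊑y = ⊑-trans (x∧y≤x x y) x⊑z , ⊑-trans z⊑y (y≤x∨y x y)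

  InP-comm : ∀ S {x y} → InP S (x , y) → InP S (y , x)
  InP-comm S = All.map Between-comm

  cardP≡∑∑ : ∀ S → cardP S ≡ ∑∑ (allFin n) (λ x y → χ (InP? S (x , y)))
  cardP≡∑∑ S = trans (length-filter≡∑χ (InP? S) (cartesianProduct (allFin n) (allFin n)))
                     (∑-cartesianProduct (allFin n) (allFin n) (χ ∘ InP? S))

  module _ {a b : Fin n} where

    ¬InP-diag : a ≢ b → ∀ x → ¬ InP (a ∷ b ∷ []) (x , x)
    ¬InP-diag a≢b x (between-a ∷ between-b ∷ []) =
      a≢b (trans (Between-diag between-a) (sym (Between-diag between-b)))

    InP-pair-of-⊑ : a ⊑ b → ∀ {x y} → x ⊑ a → b ⊑ y → InP (a ∷ b ∷ []) (x , y)
    InP-pair-of-⊑ a⊑b x⊑a b⊑y =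
      Between-of-⊑ x⊑a (⊑-trans a⊑b b⊑y) ∷ Between-of-⊑ (⊑-trans x⊑a a⊑b) b⊑y ∷ []

    cardP-pair-even : a ≢ b → 2 ∣ cardP (a ∷ b ∷ [])
    cardP-pair-even a≢b = subst (2 ∣_) (sym (cardP≡∑∑ (a ∷ b ∷ [])))
      (∑∑-even (allFin n) (λ x y → χ (InP? (a ∷ b ∷ []) (x , y)))
        (λ x y → χ-cong (InP-comm _) (InP-comm _) _ _)
        (λ x → χ-≡0 (¬InP-diag a≢b x) _))

    cardP-pair-≥ : a ⊑ b → a ≢ b →
      2 * ∑ (allFin n) (λ x → χ (x ≤? a)) * ∑ (allFin n) (λ y → χ (b ≤? y)) ≤ cardP (a ∷ b ∷ [])
    cardP-pair-≥ a⊑b a≢b = begin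
      2 * ∑ xs below * ∑ xs above                        ≡⟨ *-assoc 2 (∑ xs below) (∑ xs above) ⟩
      2 * (∑ xs below * ∑ xs above)                      ≡⟨ cong (2 *_) (sym (∑∑-separable xs below above)) ⟩
      2 * ∑∑ xs (λ x y → below x * above y)              ≡⟨ cong (2 *_) (∑-cong xs λ x → ∑-cong xs λ y → sym (χ-×-dec (x ≤? a) (b ≤? y))) ⟩
      2 * ∑∑ xs corner                                   ≡⟨ sym (∑∑-symmetrise xs corner) ⟩
      ∑∑ xs (λ x y → corner x y + corner y x)            ≤⟨ ∑-mono-≤ xs (λ x → ∑-mono-≤ xs (λ y → corners≤InP x y)) ⟩
      ∑∑ xs (λ x y → χ (InP? (a ∷ b ∷ []) (x , y)))      ≡⟨ sym (cardP≡∑∑ (a ∷ b ∷ [])) ⟩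
      cardP (a ∷ b ∷ [])                                 ∎
      where
      open ≤-Reasoning
      xs : List (Fin n)
      xs = allFin n
      below above : Fin n → ℕ
      below x = χ (x ≤? a)
      above y = χ (b ≤? y)
      corner : Fin n → Fin n → ℕ
      corner x y = χ ((x ≤? a) ×-dec (b ≤? y))
      corners≤InP : ∀ x y → corner x y + corner y x ≤ χ (InP? (a ∷ b ∷ []) (x , y))
      corners≤InP x y = χ+χ≤χ
        (λ (x⊑a , b⊑y) → InP-pair-of-⊑ a⊑b x⊑a b⊑y)
        (λ (y⊑a , b⊑x) → InP-comm _ (InP-pair-of-⊑ a⊑b y⊑a b⊑x))
        (λ ((_ , b⊑y) , (y⊑a , _)) → a≢b (⊑-antisym a⊑b (⊑-trans b⊑y y⊑a)))
        ((x ≤? a) ×-dec (b ≤? y)) ((y ≤? a) ×-dec (b ≤? x)) (InP? (a ∷ b ∷ []) (x , y))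

  cardInterval-from-least : ∀ {⊥ d} → (∀ x → ⊥ ⊑ x) →
                            cardInterval ⊥ d ≡ ∑ (allFin n) (λ x → χ (x ≤? d))
  cardInterval-from-least {⊥} {d} least = trans (length-filter≡∑χ _ (allFin n))
    (∑-cong (allFin n) (λ x → χ-cong proj₂ (least x ,_) ((⊥ ≤? x) ×-dec (x ≤? d)) (x ≤? d)))

  cardInterval-to-greatest : ∀ {c ⊤} → (∀ x → x ⊑ ⊤) →
                             cardInterval c ⊤ ≡ ∑ (allFin n) (λ x → χ (c ≤? x))
  cardInterval-to-greatest {c} {⊤} greatest = trans (length-filter≡∑χ _ (allFin n))
    (∑-cong (allFin n) (λ x → χ-cong proj₁ (_, greatest x) ((c ≤? x) ×-dec (x ≤? ⊤)) (c ≤? x)))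

lemma17 : (n : ℕ) (_⊑_ : Rel (Fin n) 0ℓ) (_∨_ _∧_ : Op₂ (Fin n)) (𝟙 𝟘 : Fin n)
          (BL : IsBoundedLattice _≡_ _⊑_ _∨_ _∧_ 𝟙 𝟘) (a b : Fin n) →
          a ⊑ b → a ≢ b →
          let open FinLattice (IsBoundedLattice.isLattice BL) in
          2 ∣ cardP (a ∷ b ∷ [])
          × 2 * cardInterval 𝟘 a * cardInterval b 𝟙 ≤ cardP (a ∷ b ∷ [])
lemma17 n _⊑_ _∨_ _∧_ 𝟙 𝟘 BL a b a⊑b a≢b =
  cardP-pair-even isLattice a≢b ,
  subst (_≤ cardP (a ∷ b ∷ []))
    (sym (cong₂ (λ below above → 2 * below * above)
      (cardInterval-from-least isLattice minimum) (cardInterval-to-greatest isLattice maximum)))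
    (cardP-pair-≥ isLattice a⊑b a≢b)
  where
  open IsBoundedLattice BL using (isLattice; minimum; maximum)
  open FinLattice isLattice using (cardP)
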